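{- Let $G$ be a graph and $X\subseteq V(G)$ a vertex separator such that $V(G)\setminus X=A\cup B$ with $A,B$ disjoint and no edge between $A$ and $B$. Let $T\subseteq X$ be an independent set of $G$, and let $\mathcal{C}_T$ be the subgraph of $\mathcal{M}_{IS}(G)$ induced by the independent sets $S$ of $G$ with $S\cap X=T$. Then $\mathcal{C}_T$ is isomorphic to the Cartesian product $\mathcal{M}_{IS}(G[A\setminus N_A(T)])\,\Box\,\mathcal{M}_{IS}(G[B\setminus N_B(T)])$.
   Context: $\mathcal{M}_{IS}(H)$ is the independent set Glauber graph of a graph $H$: vertices are the independent sets of $H$, and two are adjacent iff their symmetric difference has exactly one vertex. $N_A(T)$ (resp. $N_B(T)$) is the set of vertices of $A$ (resp. $B$) adjacent to some vertex of $T$. The Cartesian product $H\Box J$ has vertex set $V(H)\times V(J)$, with $(h_1,j_1)\sim(h_2,j_2)$ iff either $h_1=h_2$ and $j_1j_2\in E(J)$, or $h_1h_2\in E(H)$ and $j_1=j_2$. -}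

module Defs where

open import Data.Nat using (ℕ; zero; suc)
open import Data.Bool using (Bool; true; false; T; _∧_)
open import Data.Fin using (Fin; zero; suc)
open import Data.Fin.Properties using (any?; all?)
open import Data.Fin.Subset using (Subset; inside; outside; _∈_; _∩_; _∪_; _─_; ∣_∣)
open import Data.Fin.Subset.Properties using (_∈?_)
open import Data.Vec using (Vec; []; _∷_; tabulate)
open import Data.Vec.Properties using (≡-dec)
import Data.Bool.Properties as BoolP
open import Data.Product using (Σ; _×_; _,_; proj₁; ∃)
open import Relation.Binary.PropositionalEquality using (_≡_)
open import Relation.Nullary using (¬_; Dec; yes; no)
open import Relation.Nullary.Decidable using (True; ⌊_⌋; _×-dec_; _→-dec_; ¬?)
open import Function.Bundles using (_⤖_; Bijection; _⇔_)

record Graph : Set where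
  field
    n       : ℕ
    adj     : Fin n → Fin n → Bool
    symmetric   : ∀ u v → adj u v ≡ adj v u
    irreflexive : ∀ v → adj v v ≡ false

  Edge : Fin n → Fin n → Set
  Edge u v = T (adj u v)

  Edge? : ∀ u v → Dec (Edge u v)
  Edge? u v with adj u v
  ... | true  = yes _
  ... | false = no (λ ())

open Graph public

Independent : (G : Graph) → Subset (n G) → Set
Independent G S = ∀ u v → u ∈ S → v ∈ S → ¬ Edge G u v

independent? : (G : Graph) → (S : Subset (n G)) → Dec (Independent G S)
independent? G S =
  all? λ u → all? λ v → (u ∈? S) →-dec ((v ∈? S) →-dec ¬? (Edge? G u v))

Nbhd : (G : Graph) → Subset (n G) → Subset (n G)
Nbhd G T = tabulate λ v → ⌊ any? (λ t → (t ∈? T) ×-dec Edge? G v t) ⌋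

N[_] : {G : Graph} → Subset (n G) → Subset (n G) → Subset (n G)
N[_] {G} W T = W ∩ Nbhd G T

-- Induced subgraph G[W], with vertex set Fin ∣ W ∣ enumerating W in order

members : ∀ {m} (W : Subset m) → Fin ∣ W ∣ → Fin m
members (true ∷ W) zero    = zero
members (true ∷ W) (suc i) = suc (members W i)
members (false ∷ W) i      = suc (members W i)

induced : (G : Graph) → Subset (n G) → Graph
induced G W = record
  { n = ∣ W ∣
  ; adj = λ i j → adj G (members W i) (members W j)
  ; symmetric = λ i j → symmetric G (members W i) (members W j)
  ; irreflexive = λ i → irreflexive G (members W i)
  }

record AGraph : Set₁ where
  field
    V : Set
    E : V → V → Set

open AGraph public

record _≅_ (H J : AGraph) : Set where
  field
    bij   : V H ⤖ V J
    edges : ∀ x y → E H x y ⇔ E J (Bijection.to bij x) (Bijection.to bij y)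

_⊕_ : ∀ {m} → Subset m → Subset m → Subset m
S ⊕ S' = (S ─ S') ∪ (S' ─ S)

ISVertex : Graph → Set
ISVertex H = Σ (Subset (n H)) λ S → True (independent? H S)

M-IS : Graph → AGraph
M-IS H = record
  { V = ISVertex H
  ; E = λ S S' → ∣ proj₁ S ⊕ proj₁ S' ∣ ≡ 1
  }

_□_ : AGraph → AGraph → AGraph
H □ J = record
  { V = V H × V J
  ; E = λ { (h₁ , j₁) (h₂ , j₂) → (h₁ ≡ h₂ × E J j₁ j₂) Data.Sum.⊎ (E H h₁ h₂ × j₁ ≡ j₂) }
  }
  where import Data.Sum

C[_,_] : (G : Graph) → Subset (n G) → Subset (n G) → AGraph
C[ G , X ] T = record
  { V = Σ (ISVertex G) λ S → True (≡-dec BoolP._≟_ (proj₁ S ∩ X) T)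
  ; E = λ S S' → E (M-IS G) (proj₁ S) (proj₁ S')
  }

-- Write A' = A ∖ N_A(T) and B' = B ∖ N_B(T). An independent set S with S ∩ X = T
-- avoids N(T), so S = T ∪ (S ∩ A') ∪ (S ∩ B'); conversely T ∪ a ∪ b is independent
-- for independent a ⊆ A', b ⊆ B', since A' and B' avoid N(T) and no edge joins A
-- and B. This gives the bijection S ↦ (S ∩ A', S ∩ B'). Two such sets differ only
-- outside X, i.e. inside the disjoint union A' ∪ B', so the size of their symmetric
-- difference is the sum of the sizes of the symmetric differences of the two
-- components; it equals 1 exactly when one component is equal and the other
-- differs in one vertex, which is adjacency in the Cartesian product.
module Submission where

open import Data.Bool using (Bool; true; false; T)
open import Data.Bool.Properties using (T-irrelevant; T-≡; _≟_)
open import Data.Empty using (⊥-elim)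
open import Data.Fin using (Fin; zero; suc)
open import Data.Fin.Subset using (Subset; _∈_; _∉_; _∩_; _∪_; _─_; _⊆_; ∁; ⊥; ∣_∣)
open import Data.Fin.Subset.Properties
  using ( _∈?_; ⊆-antisym; ⊥⊆; drop-∷-⊆; ∉⊥; p─q⊆p; p⊆q⇒∁p⊇∁q; p∩q⊆p
        ; x∈p∪q⁺; x∈p∪q⁻; x∈p∩q⁺; x∈p∩q⁻; x∈p∧x∉q⇒x∈p─q
        ; x∈∁p⇒x∉p; x∉p⇒x∈∁p
        ; ∩-comm; ∩-distribˡ-∪; ∪-identityˡ; ∪-identityʳ )
open import Data.Nat using (ℕ; zero; suc; _+_)
open import Data.Nat.Properties using (+-suc)
open import Data.Product using (Σ; ∃; _×_; _,_; proj₁; proj₂)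
import Data.Product as Product
open import Data.Sum using (_⊎_; inj₁; inj₂; [_,_])
import Data.Sum as Sum
open import Data.Vec using ([]; _∷_; here; there; zipWith)
open import Data.Vec.Properties using (≡-dec; lookup∘tabulate; []=⇒lookup; lookup⇒[]=)
open import Defs
open import Function using (_∘_)
open import Function.Bundles using (_⇔_; mk⇔; mk↔ₛ′; Equivalence)
open import Function.Properties.Inverse using (↔⇒⤖)
open import Relation.Binary.PropositionalEquality
  using (_≡_; refl; sym; trans; cong; cong₂; subst; module ≡-Reasoning)
open import Relation.Nullary using (¬_; Dec; yes; no)
open import Relation.Nullary.Decidable using (True; toWitness; fromWitness)

private
  variable
    m : ℕ

x∈p─q⁻ : ∀ {x} (p q : Subset m) → x ∈ p ─ q → x ∈ p × x ∉ q
x∈p─q⁻ {x = zero} (true ∷ p)  (false ∷ q) here = here , λ ()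
x∈p─q⁻ {x = zero} (true ∷ p)  (true ∷ q)  ()
x∈p─q⁻ {x = zero} (false ∷ p) (true ∷ q)  ()
x∈p─q⁻ {x = zero} (false ∷ p) (false ∷ q) ()
x∈p─q⁻ (_ ∷ p) (_ ∷ q) (there x∈p─q) with x∈p─q⁻ p q x∈p─q
... | x∈p , x∉q = there x∈p , λ { (there x∈q) → x∉q x∈q }

p─p∩q⊆∁q : (p q : Subset m) → p ─ (p ∩ q) ⊆ ∁ q
p─p∩q⊆∁q p q x∈ with x∈p─q⁻ p (p ∩ q) x∈
... | x∈p , x∉p∩q = x∉p⇒x∈∁p λ x∈q → x∉p∩q (x∈p∩q⁺ (x∈p , x∈q))

∪-⊆ : {p q r : Subset m} → p ⊆ r → q ⊆ r → p ∪ q ⊆ r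
∪-⊆ {p = p} {q} p⊆r q⊆r x∈ = [ p⊆r , q⊆r ] (x∈p∪q⁻ p q x∈)

⊆∁-sym : {p q : Subset m} → p ⊆ ∁ q → q ⊆ ∁ p
⊆∁-sym p⊆∁q x∈q = x∉p⇒x∈∁p λ x∈p → x∈∁p⇒x∉p (p⊆∁q x∈p) x∈q

p⊆q∪r∧p⊆∁q⇒p⊆r : {p q r : Subset m} → p ⊆ q ∪ r → p ⊆ ∁ q → p ⊆ r
p⊆q∪r∧p⊆∁q⇒p⊆r {q = q} {r} p⊆q∪r p⊆∁q x∈p =
  [ ⊥-elim ∘ x∈∁p⇒x∉p (p⊆∁q x∈p) , (λ x∈r → x∈r) ] (x∈p∪q⁻ q r (p⊆q∪r x∈p))

p⊆q⇒p∩q≡p : {p q : Subset m} → p ⊆ q → p ∩ q ≡ p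
p⊆q⇒p∩q≡p {p = p} {q} p⊆q = ⊆-antisym (p∩q⊆p p q) (λ x∈p → x∈p∩q⁺ (x∈p , p⊆q x∈p))

p⊆∁q⇒p∩q≡⊥ : {p q : Subset m} → p ⊆ ∁ q → p ∩ q ≡ ⊥
p⊆∁q⇒p∩q≡⊥ {p = p} {q} p⊆∁q = ⊆-antisym ⊆⊥ ⊥⊆
  where
  ⊆⊥ : p ∩ q ⊆ ⊥
  ⊆⊥ x∈ with x∈p∩q⁻ p q x∈
  ... | x∈p , x∈q = ⊥-elim (x∈∁p⇒x∉p (p⊆∁q x∈p) x∈q)

x∈p⊕q⁻ : ∀ {x} (p q : Subset m) → x ∈ p ⊕ q → (x ∈ p × x ∉ q) ⊎ (x ∈ q × x ∉ p)
x∈p⊕q⁻ p q = Sum.map (x∈p─q⁻ p q) (x∈p─q⁻ q p) ∘ x∈p∪q⁻ (p ─ q) (q ─ p)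

p⊕q⊆p∪q : (p q : Subset m) → p ⊕ q ⊆ p ∪ q
p⊕q⊆p∪q p q = x∈p∪q⁺ ∘ Sum.map proj₁ proj₁ ∘ x∈p⊕q⁻ p q

p∩r≡q∩r⇒p⊕q⊆∁r : (p q r : Subset m) → p ∩ r ≡ q ∩ r → p ⊕ q ⊆ ∁ r
p∩r≡q∩r⇒p⊕q⊆∁r p q r p∩r≡q∩r {x} x∈ = x∉p⇒x∈∁p λ x∈r →
  [ (λ (x∈p , x∉q) → x∉q (move p∩r≡q∩r x∈p x∈r))
  , (λ (x∈q , x∉p) → x∉p (move (sym p∩r≡q∩r) x∈q x∈r))
  ] (x∈p⊕q⁻ p q x∈)
  where
  move : {s s' : Subset _} → s ∩ r ≡ s' ∩ r → x ∈ s → x ∈ r → x ∈ s'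
  move {s' = s'} eq x∈s x∈r = proj₁ (x∈p∩q⁻ s' r (subst (x ∈_) eq (x∈p∩q⁺ (x∈s , x∈r))))

∣p⊕p∣≡0 : (p : Subset m) → ∣ p ⊕ p ∣ ≡ 0
∣p⊕p∣≡0 []          = refl
∣p⊕p∣≡0 (true ∷ p)  = ∣p⊕p∣≡0 p
∣p⊕p∣≡0 (false ∷ p) = ∣p⊕p∣≡0 p

∣p⊕q∣≡0⇒p≡q : (p q : Subset m) → ∣ p ⊕ q ∣ ≡ 0 → p ≡ q
∣p⊕q∣≡0⇒p≡q []          []          _ = refl
∣p⊕q∣≡0⇒p≡q (true ∷ p)  (true ∷ q)  e = cong (true ∷_) (∣p⊕q∣≡0⇒p≡q p q e)
∣p⊕q∣≡0⇒p≡q (false ∷ p) (false ∷ q) e = cong (false ∷_) (∣p⊕q∣≡0⇒p≡q p q e)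

m+n≡1⇒ : ∀ m {n} → m + n ≡ 1 → (m ≡ 0 × n ≡ 1) ⊎ (m ≡ 1 × n ≡ 0)
m+n≡1⇒ zero          e  = inj₁ (refl , e)
m+n≡1⇒ (suc zero) {zero} _ = inj₂ (refl , refl)

-- restrict W S is S ∩ W, re-indexed by the vertices Fin ∣ W ∣ of `induced G W`;
-- extend W is its inverse on subsets of W.

restrict : (W : Subset m) → Subset m → Subset ∣ W ∣
restrict []          []      = []
restrict (true ∷ W)  (x ∷ S) = x ∷ restrict W S
restrict (false ∷ W) (x ∷ S) = restrict W S

extend : (W : Subset m) → Subset ∣ W ∣ → Subset m
extend []          a       = []
extend (true ∷ W)  (x ∷ a) = x ∷ extend W a
extend (false ∷ W) a       = false ∷ extend W a

members∈ : (W : Subset m) (i : Fin ∣ W ∣) → members W i ∈ W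
members∈ (true ∷ W)  zero    = here
members∈ (true ∷ W)  (suc i) = there (members∈ W i)
members∈ (false ∷ W) i       = there (members∈ W i)

∈restrict⇒members∈ : (W S : Subset m) {i : Fin ∣ W ∣} → i ∈ restrict W S → members W i ∈ S
∈restrict⇒members∈ (true ∷ W)  (x ∷ S) {zero}  here         = here
∈restrict⇒members∈ (true ∷ W)  (x ∷ S) {suc i} (there i∈)   = there (∈restrict⇒members∈ W S i∈)
∈restrict⇒members∈ (false ∷ W) (x ∷ S)         i∈           = there (∈restrict⇒members∈ W S i∈)

∈extend⇒members : (W : Subset m) (a : Subset ∣ W ∣) {v : Fin m}
                → v ∈ extend W a → ∃ λ i → i ∈ a × members W i ≡ v
∈extend⇒members (true ∷ W) (x ∷ a) here = zero , here , refl
∈extend⇒members (true ∷ W) (x ∷ a) (there v∈) with ∈extend⇒members W a v∈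
... | i , i∈a , refl = suc i , there i∈a , refl
∈extend⇒members (false ∷ W) a (there v∈) with ∈extend⇒members W a v∈
... | i , i∈a , refl = i , i∈a , refl

extend⊆ : (W : Subset m) (a : Subset ∣ W ∣) → extend W a ⊆ W
extend⊆ W a v∈ with ∈extend⇒members W a v∈
... | i , _ , refl = members∈ W i

restrict-extend : (W : Subset m) (a : Subset ∣ W ∣) → restrict W (extend W a) ≡ a
restrict-extend []          []      = refl
restrict-extend (true ∷ W)  (x ∷ a) = cong (x ∷_) (restrict-extend W a)
restrict-extend (false ∷ W) a       = restrict-extend W a

extend-restrict : (W S : Subset m) → extend W (restrict W S) ≡ S ∩ W
extend-restrict []          []          = refl
extend-restrict (true ∷ W)  (true ∷ S)  = cong (true ∷_) (extend-restrict W S)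
extend-restrict (true ∷ W)  (false ∷ S) = cong (false ∷_) (extend-restrict W S)
extend-restrict (false ∷ W) (true ∷ S)  = cong (false ∷_) (extend-restrict W S)
extend-restrict (false ∷ W) (false ∷ S) = cong (false ∷_) (extend-restrict W S)

restrict-zipWith : (f : Bool → Bool → Bool) (W p q : Subset m)
                 → restrict W (zipWith f p q) ≡ zipWith f (restrict W p) (restrict W q)
restrict-zipWith f []          []      []      = refl
restrict-zipWith f (true ∷ W)  (x ∷ p) (y ∷ q) = cong (f x y ∷_) (restrict-zipWith f W p q)
restrict-zipWith f (false ∷ W) (x ∷ p) (y ∷ q) = restrict-zipWith f W p q

restrict-⊕ : (W p q : Subset m) → restrict W (p ⊕ q) ≡ restrict W p ⊕ restrict W q
restrict-⊕ W p q = begin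
  restrict W ((p ─ q) ∪ (q ─ p))
    ≡⟨ restrict-zipWith _ W (p ─ q) (q ─ p) ⟩
  restrict W (p ─ q) ∪ restrict W (q ─ p)
    ≡⟨ cong₂ _∪_ (restrict-zipWith _ W p q) (restrict-zipWith _ W q p) ⟩
  restrict W p ⊕ restrict W q ∎
  where open ≡-Reasoning

restrict-⊆∁ : (W p : Subset m) → p ⊆ ∁ W → restrict W p ≡ ⊥
restrict-⊆∁ []          []          _    = refl
restrict-⊆∁ (true ∷ W)  (true ∷ p)  p⊆∁W = ⊥-elim (x∈∁p⇒x∉p (p⊆∁W here) here)
restrict-⊆∁ (true ∷ W)  (false ∷ p) p⊆∁W = cong (false ∷_) (restrict-⊆∁ W p (drop-∷-⊆ p⊆∁W))
restrict-⊆∁ (false ∷ W) (_ ∷ p)     p⊆∁W = restrict-⊆∁ W p (drop-∷-⊆ p⊆∁W)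

∣p∣≡∣restrict∣+∣restrict∣ : (W₁ W₂ p : Subset m) → W₁ ⊆ ∁ W₂ → p ⊆ W₁ ∪ W₂
                          → ∣ p ∣ ≡ ∣ restrict W₁ p ∣ + ∣ restrict W₂ p ∣
∣p∣≡∣restrict∣+∣restrict∣ [] [] [] _ _ = refl
∣p∣≡∣restrict∣+∣restrict∣ (w₁ ∷ W₁) (w₂ ∷ W₂) (x ∷ p) W₁⊆∁W₂ p⊆W₁∪W₂
  with ∣p∣≡∣restrict∣+∣restrict∣ W₁ W₂ p (drop-∷-⊆ W₁⊆∁W₂) (drop-∷-⊆ p⊆W₁∪W₂)
∣p∣≡∣restrict∣+∣restrict∣ (true ∷ W₁)  (true ∷ W₂)  _ W₁⊆∁W₂ _ | _ =
  ⊥-elim (x∈∁p⇒x∉p (W₁⊆∁W₂ here) here)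
∣p∣≡∣restrict∣+∣restrict∣ (true ∷ W₁)  (false ∷ W₂) (true ∷ p)  _ _ | ih = cong suc ih
∣p∣≡∣restrict∣+∣restrict∣ (true ∷ W₁)  (false ∷ W₂) (false ∷ p) _ _ | ih = ih
∣p∣≡∣restrict∣+∣restrict∣ (false ∷ W₁) (true ∷ W₂)  (true ∷ p)  _ _ | ih =
  trans (cong suc ih) (sym (+-suc _ _))
∣p∣≡∣restrict∣+∣restrict∣ (false ∷ W₁) (true ∷ W₂)  (false ∷ p) _ _ | ih = ih
∣p∣≡∣restrict∣+∣restrict∣ (false ∷ W₁) (false ∷ W₂) (true ∷ p)  _ p⊆W₁∪W₂ | _
  with () ← p⊆W₁∪W₂ here
∣p∣≡∣restrict∣+∣restrict∣ (false ∷ W₁) (false ∷ W₂) (false ∷ p) _ _ | ih = ih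

NoEdgeBetween : (G : Graph) → Subset (n G) → Subset (n G) → Set
NoEdgeBetween G P Q = ∀ u v → u ∈ P → v ∈ Q → ¬ Edge G u v

module _ (G : Graph) where

  Edge-sym : ∀ {u v} → Edge G u v → Edge G v u
  Edge-sym {u} {v} = subst T (symmetric G u v)

  NoEdgeBetween-mono : {P P' Q Q' : Subset (n G)} → P ⊆ P' → Q ⊆ Q'
                     → NoEdgeBetween G P' Q' → NoEdgeBetween G P Q
  NoEdgeBetween-mono P⊆P' Q⊆Q' none u v u∈P v∈Q = none u v (P⊆P' u∈P) (Q⊆Q' v∈Q)

  Independent-∪ : {P Q : Subset (n G)} → Independent G P → Independent G Q
                → NoEdgeBetween G P Q → Independent G (P ∪ Q)
  Independent-∪ {P} {Q} indP indQ none u v u∈ v∈ with x∈p∪q⁻ P Q u∈ | x∈p∪q⁻ P Q v∈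
  ... | inj₁ u∈P | inj₁ v∈P = indP u v u∈P v∈P
  ... | inj₁ u∈P | inj₂ v∈Q = none u v u∈P v∈Q
  ... | inj₂ u∈Q | inj₁ v∈P = none v u v∈P u∈Q ∘ Edge-sym
  ... | inj₂ u∈Q | inj₂ v∈Q = indQ u v u∈Q v∈Q

  restrict-Independent : (W S : Subset (n G)) → Independent G S
                       → Independent (induced G W) (restrict W S)
  restrict-Independent W S indS i j i∈ j∈ =
    indS (members W i) (members W j) (∈restrict⇒members∈ W S i∈) (∈restrict⇒members∈ W S j∈)

  extend-Independent : (W : Subset (n G)) (a : Subset ∣ W ∣) → Independent (induced G W) a
                     → Independent G (extend W a)
  extend-Independent W a inda u v u∈ v∈ with ∈extend⇒members W a u∈ | ∈extend⇒members W a v∈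
  ... | i , i∈a , refl | j , j∈a , refl = inda i j i∈a j∈a

  ∈Nbhd⁺ : ∀ {U t v} → t ∈ U → Edge G v t → v ∈ Nbhd G U
  ∈Nbhd⁺ {U} {t} {v} t∈U e =
    lookup⇒[]= v (Nbhd G U) (trans (lookup∘tabulate _ v) (Equivalence.to T-≡ (fromWitness (t , t∈U , e))))

  ∈Nbhd⁻ : ∀ {U v} → v ∈ Nbhd G U → ∃ λ t → t ∈ U × Edge G v t
  ∈Nbhd⁻ {U} {v} v∈ = toWitness (Equivalence.from T-≡ (trans (sym (lookup∘tabulate _ v)) ([]=⇒lookup v∈)))

  NoEdgeBetween-∁Nbhd : (T : Subset (n G)) → NoEdgeBetween G T (∁ (Nbhd G T))
  NoEdgeBetween-∁Nbhd T t v t∈T v∈∁N e = x∈∁p⇒x∉p v∈∁N (∈Nbhd⁺ t∈T (Edge-sym e))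

  Independent⇒⊆∁Nbhd : {S T : Subset (n G)} → Independent G S → T ⊆ S → S ⊆ ∁ (Nbhd G T)
  Independent⇒⊆∁Nbhd {S} indS T⊆S {v} v∈S = x∉p⇒x∈∁p λ v∈N →
    let t , t∈T , e = ∈Nbhd⁻ v∈N in indS v t v∈S (T⊆S t∈T) e

Σ-True-≡ : {A : Set} {P : A → Set} (P? : ∀ x → Dec (P x)) {x y : A}
           {p : True (P? x)} {q : True (P? y)}
         → x ≡ y → _≡_ {A = Σ A (λ z → True (P? z))} (x , p) (y , q)
Σ-True-≡ P? {p = p} {q} refl = cong (_ ,_) (T-irrelevant p q)

ISVertex-≡⇔∣⊕∣≡0 : (H : Graph) (S S' : ISVertex H) → S ≡ S' ⇔ ∣ proj₁ S ⊕ proj₁ S' ∣ ≡ 0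
ISVertex-≡⇔∣⊕∣≡0 H (S , _) (S' , _) = mk⇔
  (λ { refl → ∣p⊕p∣≡0 S })
  (Σ-True-≡ (independent? H) ∘ ∣p⊕q∣≡0⇒p≡q S S')

module Decomposition
  (G : Graph) (X A B T : Subset (n G))
  (A∪B≡∁X : A ∪ B ≡ ∁ X) (A∩B≡⊥ : A ∩ B ≡ ⊥)
  (noEdgeAB : NoEdgeBetween G A B) (T⊆X : T ⊆ X) (indT : Independent G T)
  where

  A' B' : Subset (n G)
  A' = A ─ N[_] {G} A T
  B' = B ─ N[_] {G} B T

  HA HB : Graph
  HA = induced G A'
  HB = induced G B'

  A⊆∁X : A ⊆ ∁ X
  A⊆∁X = subst (_ ∈_) A∪B≡∁X ∘ x∈p∪q⁺ ∘ inj₁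

  B⊆∁X : B ⊆ ∁ X
  B⊆∁X = subst (_ ∈_) A∪B≡∁X ∘ x∈p∪q⁺ ∘ inj₂

  A⊆∁B : A ⊆ ∁ B
  A⊆∁B v∈A = x∉p⇒x∈∁p λ v∈B → ∉⊥ (subst (_ ∈_) A∩B≡⊥ (x∈p∩q⁺ (v∈A , v∈B)))

  A'⊆A : A' ⊆ A
  A'⊆A = p─q⊆p A _

  B'⊆B : B' ⊆ B
  B'⊆B = p─q⊆p B _

  A'∪B'⊆∁X : A' ∪ B' ⊆ ∁ X
  A'∪B'⊆∁X = ∪-⊆ (A⊆∁X ∘ A'⊆A) (B⊆∁X ∘ B'⊆B)

  A'∪B'⊆∁N : A' ∪ B' ⊆ ∁ (Nbhd G T)
  A'∪B'⊆∁N = ∪-⊆ (p─p∩q⊆∁q A _) (p─p∩q⊆∁q B _)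

  A'⊆∁B' : A' ⊆ ∁ B'
  A'⊆∁B' = p⊆q⇒∁p⊇∁q B'⊆B ∘ A⊆∁B ∘ A'⊆A

  T⊆∁A' : T ⊆ ∁ A'
  T⊆∁A' = ⊆∁-sym (A⊆∁X ∘ A'⊆A) ∘ T⊆X

  T⊆∁B' : T ⊆ ∁ B'
  T⊆∁B' = ⊆∁-sym (B⊆∁X ∘ B'⊆B) ∘ T⊆X

  ⊆X∪A'∪B' : ∀ {S} → Independent G S → S ∩ X ≡ T → S ⊆ X ∪ (A' ∪ B')
  ⊆X∪A'∪B' {S} indS S∩X≡T {v} v∈S with v ∈? X
  ... | yes v∈X = x∈p∪q⁺ (inj₁ v∈X)
  ... | no  v∉X = x∈p∪q⁺ (inj₂ (x∈p∪q⁺ (Sum.map (into A) (into B) v∈A⊎B)))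
    where
    T⊆S : T ⊆ S
    T⊆S t∈T = proj₁ (x∈p∩q⁻ S X (subst (_ ∈_) (sym S∩X≡T) t∈T))
    v∉N : v ∉ Nbhd G T
    v∉N = x∈∁p⇒x∉p (Independent⇒⊆∁Nbhd G indS T⊆S v∈S)
    v∈A⊎B : v ∈ A ⊎ v ∈ B
    v∈A⊎B = x∈p∪q⁻ A B (subst (v ∈_) (sym A∪B≡∁X) (x∉p⇒x∈∁p v∉X))
    into : (W : Subset (n G)) → v ∈ W → v ∈ W ─ N[_] {G} W T
    into W v∈W = x∈p∧x∉q⇒x∈p─q v∈W (v∉N ∘ proj₂ ∘ x∈p∩q⁻ W _)

  join : Subset ∣ A' ∣ → Subset ∣ B' ∣ → Subset (n G)
  join a b = T ∪ (extend A' a ∪ extend B' b)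

  extends⊆A'∪B' : ∀ a b → extend A' a ∪ extend B' b ⊆ A' ∪ B'
  extends⊆A'∪B' a b = ∪-⊆ (x∈p∪q⁺ ∘ inj₁ ∘ extend⊆ A' a) (x∈p∪q⁺ ∘ inj₂ ∘ extend⊆ B' b)

  join-Independent : ∀ a b → Independent HA a → Independent HB b → Independent G (join a b)
  join-Independent a b inda indb =
    Independent-∪ G indT
      (Independent-∪ G (extend-Independent G A' a inda) (extend-Independent G B' b indb)
        (NoEdgeBetween-mono G (A'⊆A ∘ extend⊆ A' a) (B'⊆B ∘ extend⊆ B' b) noEdgeAB))
      (NoEdgeBetween-mono G (λ t∈T → t∈T) (A'∪B'⊆∁N ∘ extends⊆A'∪B' a b)
        (NoEdgeBetween-∁Nbhd G T))

  join-∩X : ∀ a b → join a b ∩ X ≡ T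
  join-∩X a b = begin
    (T ∪ (extend A' a ∪ extend B' b)) ∩ X
      ≡⟨ ∩-comm _ X ⟩
    X ∩ (T ∪ (extend A' a ∪ extend B' b))
      ≡⟨ ∩-distribˡ-∪ X T _ ⟩
    (X ∩ T) ∪ (X ∩ (extend A' a ∪ extend B' b))
      ≡⟨ cong₂ _∪_ (∩-comm X T) (∩-comm X _) ⟩
    (T ∩ X) ∪ ((extend A' a ∪ extend B' b) ∩ X)
      ≡⟨ cong₂ _∪_ (p⊆q⇒p∩q≡p T⊆X) (p⊆∁q⇒p∩q≡⊥ (A'∪B'⊆∁X ∘ extends⊆A'∪B' a b)) ⟩
    T ∪ ⊥
      ≡⟨ ∪-identityʳ T ⟩
    T ∎
    where open ≡-Reasoning

  restrict-join : ∀ W a b → restrict W (join a b)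
                ≡ restrict W T ∪ (restrict W (extend A' a) ∪ restrict W (extend B' b))
  restrict-join W a b =
    trans (restrict-zipWith _ W T _) (cong (_ ∪_) (restrict-zipWith _ W (extend A' a) _))

  restrict-A'-join : ∀ a b → restrict A' (join a b) ≡ a
  restrict-A'-join a b = begin
    restrict A' (join a b)
      ≡⟨ restrict-join A' a b ⟩
    restrict A' T ∪ (restrict A' (extend A' a) ∪ restrict A' (extend B' b))
      ≡⟨ cong₂ _∪_ (restrict-⊆∁ A' T T⊆∁A')
                   (cong₂ _∪_ (restrict-extend A' a)
                              (restrict-⊆∁ A' _ (⊆∁-sym A'⊆∁B' ∘ extend⊆ B' b))) ⟩
    ⊥ ∪ (a ∪ ⊥)
      ≡⟨ trans (∪-identityˡ _) (∪-identityʳ a) ⟩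
    a ∎
    where open ≡-Reasoning

  restrict-B'-join : ∀ a b → restrict B' (join a b) ≡ b
  restrict-B'-join a b = begin
    restrict B' (join a b)
      ≡⟨ restrict-join B' a b ⟩
    restrict B' T ∪ (restrict B' (extend A' a) ∪ restrict B' (extend B' b))
      ≡⟨ cong₂ _∪_ (restrict-⊆∁ B' T T⊆∁B')
                   (cong₂ _∪_ (restrict-⊆∁ B' _ (A'⊆∁B' ∘ extend⊆ A' a)) (restrict-extend B' b)) ⟩
    ⊥ ∪ (⊥ ∪ b)
      ≡⟨ trans (∪-identityˡ _) (∪-identityˡ b) ⟩
    b ∎
    where open ≡-Reasoning

  join-restrict : ∀ {S} → Independent G S → S ∩ X ≡ T → join (restrict A' S) (restrict B' S) ≡ S
  join-restrict {S} indS S∩X≡T = begin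
    T ∪ (extend A' (restrict A' S) ∪ extend B' (restrict B' S))
      ≡⟨ cong₂ _∪_ (sym S∩X≡T) (cong₂ _∪_ (extend-restrict A' S) (extend-restrict B' S)) ⟩
    (S ∩ X) ∪ ((S ∩ A') ∪ (S ∩ B'))
      ≡⟨ cong ((S ∩ X) ∪_) (sym (∩-distribˡ-∪ S A' B')) ⟩
    (S ∩ X) ∪ (S ∩ (A' ∪ B'))
      ≡⟨ sym (∩-distribˡ-∪ S X (A' ∪ B')) ⟩
    S ∩ (X ∪ (A' ∪ B'))
      ≡⟨ p⊆q⇒p∩q≡p (⊆X∪A'∪B' indS S∩X≡T) ⟩
    S ∎
    where open ≡-Reasoning

  CVertex : Set
  CVertex = V (C[ G , X ] T)

  carrier : CVertex → Subset (n G)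
  carrier ((S , _) , _) = S

  carrier-Independent : (c : CVertex) → Independent G (carrier c)
  carrier-Independent ((_ , indS) , _) = toWitness indS

  carrier-∩X : (c : CVertex) → carrier c ∩ X ≡ T
  carrier-∩X (_ , S∩X≡T) = toWitness S∩X≡T

  ∣⊕∣≡∣⊕A'∣+∣⊕B'∣ : (c c' : CVertex) → let S = carrier c ; S' = carrier c' in
    ∣ S ⊕ S' ∣ ≡ ∣ restrict A' S ⊕ restrict A' S' ∣ + ∣ restrict B' S ⊕ restrict B' S' ∣
  ∣⊕∣≡∣⊕A'∣+∣⊕B'∣ c c' =
    trans (∣p∣≡∣restrict∣+∣restrict∣ A' B' (S ⊕ S') A'⊆∁B' S⊕S'⊆A'∪B')
          (cong₂ _+_ (cong ∣_∣ (restrict-⊕ A' S S')) (cong ∣_∣ (restrict-⊕ B' S S')))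
    where
    S = carrier c
    S' = carrier c'
    S⊕S'⊆A'∪B' : S ⊕ S' ⊆ A' ∪ B'
    S⊕S'⊆A'∪B' = p⊆q∪r∧p⊆∁q⇒p⊆r
      (∪-⊆ (⊆X∪A'∪B' (carrier-Independent c) (carrier-∩X c))
           (⊆X∪A'∪B' (carrier-Independent c') (carrier-∩X c'))
       ∘ p⊕q⊆p∪q S S')
      (p∩r≡q∩r⇒p⊕q⊆∁r S S' X (trans (carrier-∩X c) (sym (carrier-∩X c'))))

  ProductVertex : Set
  ProductVertex = V (M-IS HA □ M-IS HB)

  split : CVertex → ProductVertex
  split c = (restrict A' S , fromWitness (restrict-Independent G A' S (carrier-Independent c)))
          , (restrict B' S , fromWitness (restrict-Independent G B' S (carrier-Independent c)))
    where S = carrier c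

  merge : ProductVertex → CVertex
  merge ((a , inda) , (b , indb)) =
    (join a b , fromWitness (join-Independent a b (toWitness inda) (toWitness indb)))
    , fromWitness (join-∩X a b)

  merge∘split : ∀ c → merge (split c) ≡ c
  merge∘split c =
    Σ-True-≡ (λ S → ≡-dec _≟_ (proj₁ S ∩ X) T)
      (Σ-True-≡ (independent? G) (join-restrict (carrier-Independent c) (carrier-∩X c)))

  split∘merge : ∀ p → split (merge p) ≡ p
  split∘merge ((a , _) , (b , _)) =
    cong₂ _,_ (Σ-True-≡ (independent? HA) (restrict-A'-join a b))
              (Σ-True-≡ (independent? HB) (restrict-B'-join a b))

  split-edges : ∀ c c' → E (C[ G , X ] T) c c' ⇔ E (M-IS HA □ M-IS HB) (split c) (split c')
  split-edges c c' = mk⇔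
    (Sum.map (Product.map₁ (from≡ HA)) (Product.map₂ (from≡ HB))
      ∘ m+n≡1⇒ _ ∘ trans (sym (∣⊕∣≡∣⊕A'∣+∣⊕B'∣ c c')))
    (trans (∣⊕∣≡∣⊕A'∣+∣⊕B'∣ c c')
      ∘ [ (λ (a≡a' , e) → cong₂ _+_ (to≡ HA a≡a') e)
        , (λ (e , b≡b') → cong₂ _+_ e (to≡ HB b≡b')) ])
    where
    from≡ : (H : Graph) {S S' : ISVertex H} → ∣ proj₁ S ⊕ proj₁ S' ∣ ≡ 0 → S ≡ S'
    from≡ H = Equivalence.from (ISVertex-≡⇔∣⊕∣≡0 H _ _)
    to≡ : (H : Graph) {S S' : ISVertex H} → S ≡ S' → ∣ proj₁ S ⊕ proj₁ S' ∣ ≡ 0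
    to≡ H = Equivalence.to (ISVertex-≡⇔∣⊕∣≡0 H _ _)

  C≅M-IS□M-IS : C[ G , X ] T ≅ (M-IS HA □ M-IS HB)
  C≅M-IS□M-IS = record
    { bij   = ↔⇒⤖ (mk↔ₛ′ split merge split∘merge merge∘split)
    ; edges = split-edges
    }

lemma3 : (G : Graph) (X A B T : Subset (n G))
         → A ∪ B ≡ ∁ X
         → A ∩ B ≡ ⊥
         → (∀ a b → a ∈ A → b ∈ B → ¬ Edge G a b)
         → T ⊆ X
         → Independent G T
         → C[ G , X ] T
             ≅ (M-IS (induced G (A ─ N[_] {G} A T)) □ M-IS (induced G (B ─ N[_] {G} B T)))
lemma3 = Decomposition.C≅M-IS□M-IS
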